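{- For a partition $\lambda$ let $\widetilde{\mathrm{wt}}_{\mathbb{Z}_3}(\lambda)=\left|\{\square\in\lambda : a(\square)+1\equiv l(\square) \pmod 3\}\right|$. Define partial maps $\rho_1,\psi_2$ on partitions as follows, where $j=\lambda_1$ is the length of the first (bottom) row and $k=\lambda'_1$ the height of the first (leftmost) column of $\lambda$: - $\rho_1(\lambda)$ is defined iff $j\ge k-2$, and is the partition with column heights $j+1,\lambda'_1-1,\lambda'_2-1,\dots,\lambda'_j-1$ (zeros discarded), i.e. remove the first row, add one box, and insert it as a new first column; - $\psi_2(\lambda)$ is defined iff $j\le k+3$, and is the partition with row lengths $k+2,\lambda_1-1,\dots,\lambda_k-1$ (zeros discarded), i.e. remove the first column, add two boxes, and insert it as a new first row. Then if $\rho_1(\lambda)$ is defined, $\widetilde{\mathrm{wt}}_{\mathbb{Z}_3}(\rho_1(\lambda))=\widetilde{\mathrm{wt}}_{\mathbb{Z}_3}(\lambda)$, and if $\psi_2(\lambda)$ is defined, $\widetilde{\mathrm{wt}}_{\mathbb{Z}_3}(\psi_2(\lambda))=\widetilde{\mathrm{wt}}_{\mathbb{Z}_3}(\lambda)+1$.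
   Context: Partitions are drawn as southwest-justified Young diagrams: $\lambda_r$ is the number of boxes in the $r$-th row from the bottom, $\lambda'_c$ the height of the $c$-th column from the left. For a box $\square\in\lambda$, the arm $a(\square)$ is the number of boxes strictly above $\square$ in its column and the leg $l(\square)$ the number of boxes strictly to the right of $\square$ in its row. -}

module Defs where

open import Data.Nat using (ℕ; zero; suc; _+_; _∸_; _≤_; _%_; pred)
open import Data.Nat.Properties using (_≟_)
open import Relation.Nullary using (yes; no)
open import Data.Product using (_×_; _,_)
open import Data.List using (List; []; _∷_; length; map; filter; upTo; zip; head)
open import Data.Nat.ListAction using (sum)
open import Data.List.Relation.Unary.All using (All)
open import Data.List.Relation.Unary.Linked using (Linked)
open import Data.Maybe using (fromMaybe)
open import Data.Nat.Properties using (_<?_)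
open import Relation.Binary.PropositionalEquality using (_≡_)

-- A partition is the list of its row lengths λ₁ , λ₂ , … from the bottom
-- row upwards: all entries positive and weakly decreasing.
Partition : Set
Partition = List ℕ

IsPartition : Partition → Set
IsPartition λ′ = All (λ n → 1 ≤ n) λ′ × Linked (λ a b → b ≤ a) λ′

firstRow : Partition → ℕ
firstRow λ′ = fromMaybe 0 (head λ′)

colHeight : Partition → ℕ → ℕ
colHeight λ′ c = length (filter (λ r → c <? r) λ′)

conj : Partition → Partition
conj λ′ = map (colHeight λ′) (upTo (firstRow λ′))

-- row index r and column index c (both 0-indexed), box in row r of length len
-- arm = number of boxes strictly above (in the column), leg = strictly right.
arm : Partition → ℕ → ℕ → ℕ
arm λ′ r c = colHeight λ′ c ∸ suc r

leg : ℕ → ℕ → ℕ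
leg len c = len ∸ suc c

good : Partition → ℕ → ℕ → ℕ → ℕ
good λ′ r len c with (suc (arm λ′ r c) % 3) ≟ (leg len c % 3)
... | yes _ = 1
... | no _ = 0

rowCount : Partition → ℕ → ℕ → ℕ
rowCount λ′ r len = sum (map (good λ′ r len) (upTo len))

indexedRows : Partition → List (ℕ × ℕ)
indexedRows λ′ = zip (upTo (length λ′)) λ′

wtZ3 : Partition → ℕ
wtZ3 λ′ = sum (map (λ { (r , len) → rowCount λ′ r len }) (indexedRows λ′))

decAll : List ℕ → List ℕ
decAll xs = filter (λ n → 0 <? n) (map pred xs)

rho1 : Partition → Partition
rho1 λ′ = conj (suc (firstRow λ′) ∷ decAll (conj λ′))

psi2 : Partition → Partition
psi2 λ′ = suc (suc (length λ′)) ∷ decAll λ′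

-- Deleting the bottom row or the first column of a partition leaves every other box with the
-- same arm and leg, so the weight splits as (good boxes in that strip) + (weight of the rest).
-- Both ρ₁ and ψ₂ trade a bottom row of one partition for a first column of another with the
-- same rest λ, so only the two strip weights have to be compared. A box (r, c) is good iff
-- λ'_c + c + 1 ≡ λ_r + r (mod 3); hence the bottom-row weight counts the c < B with λ'_c + c
-- in a fixed residue class and the first-column weight counts the r < B with λ_r + r in the
-- same class (both computed in λ). For λ inside a B × B square the multisets {λ'_c + c : c < B}
-- and {λ_r + r : r < B} coincide, so the two counts agree for ρ₁. For ψ₂, with k rows, both
-- counts are extended to B = k + 3: the extra term of the row count vanishes, while of the
-- three empty rows added to the column count exactly one lies in the class.

module Submission where

import Algebra.Properties.CommutativeSemigroup
open import Data.Empty using (⊥-elim)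
open import Data.List using (List; []; _∷_; _++_; length; map; filter; applyUpTo; replicate; zip)
open import Data.List.Properties
  using (filter-accept; filter-reject; filter-none; filter-all; filter-++; map-applyUpTo;
         length-applyUpTo; ++-identityʳ)
open import Data.List.Relation.Unary.All as All using (All; []; _∷_)
import Data.List.Relation.Unary.All.Properties as All
open import Data.List.Relation.Unary.Linked using (Linked; []; [-]; _∷_)
import Data.List.Relation.Unary.Linked as Linked
import Data.List.Relation.Unary.Linked.Properties as Linked
open import Data.Nat
  using (ℕ; zero; suc; _+_; _∸_; _%_; _<_; _≤_; pred; z≤n; s≤s; s≤s⁻¹; NonZero; >-nonZero)
open import Data.Nat.DivMod using (%-distribˡ-+; [m+n]%n≡m%n)
open import Data.Nat.ListAction using (sum)
open import Data.Nat.Properties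
open import Data.Product using (_×_; _,_)
open import Function.Base using (_∘_; id)
open import Function.Bundles using (_⇔_; mk⇔; Equivalence)
open import Relation.Nullary using (Dec; yes; no; ¬_)
open import Relation.Binary.PropositionalEquality
  using (_≡_; refl; sym; trans; cong; cong₂; subst; module ≡-Reasoning)

open import Defs

open Algebra.Properties.CommutativeSemigroup +-commutativeSemigroup
  using (x∙yz≈y∙xz; xy∙z≈xz∙y; interchange)
open ≡-Reasoning

indicator : {P : Set} → Dec P → ℕ
indicator (yes _) = 1
indicator (no _)  = 0

indicator-cong : {P Q : Set} → P ⇔ Q → (p? : Dec P) (q? : Dec Q) → indicator p? ≡ indicator q?
indicator-cong _   (yes _) (yes _) = refl
indicator-cong P⇔Q (yes p) (no ¬q) = ⊥-elim (¬q (Equivalence.to P⇔Q p))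
indicator-cong P⇔Q (no ¬p) (yes q) = ⊥-elim (¬p (Equivalence.from P⇔Q q))
indicator-cong _   (no _)  (no _)  = refl

Σ< : ℕ → (ℕ → ℕ) → ℕ
Σ< zero    f = 0
Σ< (suc n) f = f 0 + Σ< n (λ i → f (suc i))

Σ<-cong : ∀ n {f g : ℕ → ℕ} → (∀ i → i < n → f i ≡ g i) → Σ< n f ≡ Σ< n g
Σ<-cong zero    eq = refl
Σ<-cong (suc n) eq = cong₂ _+_ (eq 0 (s≤s z≤n)) (Σ<-cong n (λ i i<n → eq (suc i) (s≤s i<n)))

Σ<-suc : ∀ n f → Σ< (suc n) f ≡ Σ< n f + f n
Σ<-suc zero    f = +-comm (f 0) 0
Σ<-suc (suc n) f = trans (cong (f 0 +_) (Σ<-suc n (λ i → f (suc i)))) (sym (+-assoc (f 0) _ _))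

Σ<-+ : ∀ m n f → Σ< (m + n) f ≡ Σ< m f + Σ< n (λ i → f (m + i))
Σ<-+ zero    n f = refl
Σ<-+ (suc m) n f = trans (cong (f 0 +_) (Σ<-+ m n (λ i → f (suc i)))) (sym (+-assoc (f 0) _ _))

Σ<-∸ : ∀ {m n} f → m ≤ n → Σ< n f ≡ Σ< m f + Σ< (n ∸ m) (λ i → f (m + i))
Σ<-∸ {m} {n} f m≤n = trans (cong (λ k → Σ< k f) (sym (m+[n∸m]≡n m≤n))) (Σ<-+ m (n ∸ m) f)

sum-map-applyUpTo : ∀ n (g f : ℕ → ℕ) → sum (map g (applyUpTo f n)) ≡ Σ< n (λ i → g (f i))
sum-map-applyUpTo zero    g f = refl
sum-map-applyUpTo (suc n) g f = cong (g (f 0) +_) (sum-map-applyUpTo n g (λ i → f (suc i)))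

length-filter-applyUpTo : ∀ n {P : ℕ → Set} (P? : ∀ x → Dec (P x)) (f : ℕ → ℕ) →
  length (filter P? (applyUpTo f n)) ≡ Σ< n (λ i → indicator (P? (f i)))
length-filter-applyUpTo zero    P? f = refl
length-filter-applyUpTo (suc n) P? f with P? (f 0)
... | yes _ = cong suc (length-filter-applyUpTo n P? (λ i → f (suc i)))
... | no  _ = length-filter-applyUpTo n P? (λ i → f (suc i))

Σ<-indicator-< : ∀ v n → v ≤ n → Σ< n (λ m → indicator (m <? v)) ≡ v
Σ<-indicator-< zero    zero    _         = refl
Σ<-indicator-< zero    (suc n) _         = Σ<-indicator-< zero n z≤n
Σ<-indicator-< (suc v) (suc n) (s≤s v≤n) = cong suc (trans
  (Σ<-cong n (λ m _ → indicator-cong (mk⇔ s≤s⁻¹ s≤s) (suc m <? suc v) (m <? v)))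
  (Σ<-indicator-< v n v≤n))

+-%-congˡ : ∀ k {m n d} .{{_ : NonZero d}} → m % d ≡ n % d → (k + m) % d ≡ (k + n) % d
+-%-congˡ k {m} {n} {d} eq = begin
  (k + m) % d          ≡⟨ %-distribˡ-+ k m d ⟩
  (k % d + m % d) % d  ≡⟨ cong (λ x → (k % d + x) % d) eq ⟩
  (k % d + n % d) % d  ≡⟨ %-distribˡ-+ k n d ⟨
  (k + n) % d          ∎

suc-%-cancel : ∀ {m n} d .{{_ : NonZero d}} → suc m % d ≡ suc n % d → m % d ≡ n % d
suc-%-cancel {m} {n} (suc d) eq = begin
  m % suc d            ≡⟨ [m+n]%n≡m%n m (suc d) ⟨
  (m + suc d) % suc d  ≡⟨ cong (_% suc d) (rotate m) ⟩
  (d + suc m) % suc d  ≡⟨ +-%-congˡ d eq ⟩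
  (d + suc n) % suc d  ≡⟨ cong (_% suc d) (rotate n) ⟨
  (n + suc d) % suc d  ≡⟨ [m+n]%n≡m%n n (suc d) ⟩
  n % suc d            ∎
  where
  rotate : ∀ x → x + suc d ≡ d + suc x
  rotate x = trans (+-comm x (suc d)) (sym (+-suc d x))

+-%-cancelˡ : ∀ k {m n d} .{{_ : NonZero d}} → (k + m) % d ≡ (k + n) % d → m % d ≡ n % d
+-%-cancelˡ zero    eq = eq
+-%-cancelˡ (suc k) {d = d} eq = +-%-cancelˡ k (suc-%-cancel d eq)

[_≡₃_] : ℕ → ℕ → ℕ
[ m ≡₃ n ] = indicator (m % 3 ≟ n % 3)

[≡₃]-sym : ∀ m n → [ m ≡₃ n ] ≡ [ n ≡₃ m ]
[≡₃]-sym m n = indicator-cong (mk⇔ sym sym) _ _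

[≡₃]-+ˡ : ∀ k m n → [ k + m ≡₃ k + n ] ≡ [ m ≡₃ n ]
[≡₃]-+ˡ k m n = indicator-cong (mk⇔ (+-%-cancelˡ k) (+-%-congˡ k)) _ _

[≡₃]-+ʳ : ∀ k m n → [ m + k ≡₃ n + k ] ≡ [ m ≡₃ n ]
[≡₃]-+ʳ k m n = trans (cong₂ [_≡₃_] (+-comm m k) (+-comm n k)) ([≡₃]-+ˡ k m n)

[≡₃]-3+ʳ : ∀ m n → [ m ≡₃ 3 + n ] ≡ [ m ≡₃ n ]
[≡₃]-3+ʳ m n = cong (λ x → indicator (m % 3 ≟ x))
  (trans (cong (_% 3) (+-comm 3 n)) ([m+n]%n≡m%n n 3))

[1+h≡₃d]≡[h+c≡₃2+c+d] : ∀ h c d → [ suc h ≡₃ d ] ≡ [ h + c ≡₃ 2 + c + d ]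
[1+h≡₃d]≡[h+c≡₃2+c+d] h c d = begin
  [ suc h ≡₃ d ]              ≡⟨ [≡₃]-3+ʳ (suc h) d ⟨
  [ 1 + h ≡₃ 1 + (2 + d) ]    ≡⟨ [≡₃]-+ˡ 1 h (2 + d) ⟩
  [ h ≡₃ 2 + d ]              ≡⟨ [≡₃]-+ˡ c h (2 + d) ⟨
  [ c + h ≡₃ c + (2 + d) ]    ≡⟨ cong₂ [_≡₃_] (+-comm c h) (+-comm c (2 + d)) ⟩
  [ h + c ≡₃ 2 + d + c ]      ≡⟨ cong (λ x → [ h + c ≡₃ 2 + x ]) (+-comm d c) ⟩
  [ h + c ≡₃ 2 + c + d ]      ∎

[1+d≡₃t]≡[t+r≡₃1+r+d] : ∀ t r d → [ suc d ≡₃ t ] ≡ [ t + r ≡₃ 1 + r + d ]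
[1+d≡₃t]≡[t+r≡₃1+r+d] t r d = begin
  [ suc d ≡₃ t ]          ≡⟨ [≡₃]-sym (suc d) t ⟩
  [ t ≡₃ suc d ]          ≡⟨ [≡₃]-+ˡ r t (suc d) ⟨
  [ r + t ≡₃ r + suc d ]  ≡⟨ cong₂ [_≡₃_] (+-comm r t) (+-suc r d) ⟩
  [ t + r ≡₃ 1 + r + d ]  ∎

Decreasing : List ℕ → Set
Decreasing = Linked (λ a b → b ≤ a)

Decreasing-∷⁻ : ∀ {x t} → Decreasing (x ∷ t) → All (_≤ x) t
Decreasing-∷⁻ {t = []}    _   = []
Decreasing-∷⁻ {t = _ ∷ _} dec with Linked.Linked⇒All (λ p q → ≤-trans q p) ≤-refl dec
... | _ ∷ t≤x = t≤x

Decreasing-∷⁺ : ∀ {x} t → firstRow t ≤ x → Decreasing t → Decreasing (x ∷ t)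
Decreasing-∷⁺ []      _   _   = [-]
Decreasing-∷⁺ (_ ∷ _) y≤x dec = y≤x ∷ dec

row : List ℕ → ℕ → ℕ
row []       _       = 0
row (x ∷ _)  zero    = x
row (_ ∷ xs) (suc r) = row xs r

row-≥length : ∀ xs {r} → length xs ≤ r → row xs r ≡ 0
row-≥length []       _         = refl
row-≥length (_ ∷ xs) (s≤s |xs|≤r) = row-≥length xs |xs|≤r

row-≤ : ∀ {y} xs r → All (_≤ y) xs → row xs r ≤ y
row-≤ []       _       _           = z≤n
row-≤ (_ ∷ _)  zero    (x≤y ∷ _)   = x≤y
row-≤ (_ ∷ xs) (suc r) (_ ∷ xs≤y)  = row-≤ xs r xs≤y

row-applyUpTo : ∀ f n {r} → r < n → row (applyUpTo f n) r ≡ f r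
row-applyUpTo f (suc n) {zero}  _         = refl
row-applyUpTo f (suc n) {suc r} (s≤s r<n) = row-applyUpTo (λ i → f (suc i)) n r<n

applyUpTo-row : ∀ t n → length t ≤ n → applyUpTo (row t) n ≡ t ++ replicate (n ∸ length t) 0
applyUpTo-row []      zero    _          = refl
applyUpTo-row []      (suc n) _          = cong (0 ∷_) (applyUpTo-row [] n z≤n)
applyUpTo-row (y ∷ t) (suc n) (s≤s |t|≤n) = cong (y ∷_) (applyUpTo-row t n |t|≤n)

colHeight-∷-< : ∀ {y c} t → c < y → colHeight (y ∷ t) c ≡ suc (colHeight t c)
colHeight-∷-< {c = c} t c<y = cong length (filter-accept (c <?_) c<y)

colHeight-∷-≮ : ∀ {y c} t → ¬ c < y → colHeight (y ∷ t) c ≡ colHeight t c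
colHeight-∷-≮ {c = c} t c≮y = cong length (filter-reject (c <?_) c≮y)

colHeight-≡0 : ∀ {c} t → All (_≤ c) t → colHeight t c ≡ 0
colHeight-≡0 []      []          = refl
colHeight-≡0 (y ∷ t) (y≤c ∷ t≤c) =
  trans (colHeight-∷-≮ t (λ c<y → <-irrefl refl (<-≤-trans c<y y≤c))) (colHeight-≡0 t t≤c)

colHeight-0 : ∀ t → All (1 ≤_) t → colHeight t 0 ≡ length t
colHeight-0 []      []          = refl
colHeight-0 (y ∷ t) (0<y ∷ t>0) = trans (colHeight-∷-< t 0<y) (cong suc (colHeight-0 t t>0))

colHeight-∷-cong : ∀ {y y′ c c′} t t′ →
  colHeight t c ≡ colHeight t′ c′ → (c < y ⇔ c′ < y′) → colHeight (y ∷ t) c ≡ colHeight (y′ ∷ t′) c′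
colHeight-∷-cong {y} {c = c} t t′ eq c<y⇔c′<y′ with c <? y
... | yes c<y = trans (colHeight-∷-< t c<y)
  (trans (cong suc eq) (sym (colHeight-∷-< t′ (Equivalence.to c<y⇔c′<y′ c<y))))
... | no c≮y = trans (colHeight-∷-≮ t c≮y)
  (trans eq (sym (colHeight-∷-≮ t′ (c≮y ∘ Equivalence.from c<y⇔c′<y′))))

colHeight-decAll : ∀ l c → colHeight (decAll l) c ≡ colHeight l (suc c)
colHeight-decAll []                c = refl
colHeight-decAll (zero ∷ l)        c = colHeight-decAll l c
colHeight-decAll (suc zero ∷ l)    c = colHeight-decAll l c
colHeight-decAll (suc (suc x) ∷ l) c =
  colHeight-∷-cong {y = suc x} (decAll l) l (colHeight-decAll l c) (mk⇔ s≤s s≤s⁻¹)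

colHeight-≥firstRow : ∀ t {c} → Decreasing t → firstRow t ≤ c → colHeight t c ≡ 0
colHeight-≥firstRow []      _   _   = refl
colHeight-≥firstRow (y ∷ t) dec y≤c =
  colHeight-≡0 (y ∷ t) (y≤c ∷ All.map (λ z≤y → ≤-trans z≤y y≤c) (Decreasing-∷⁻ dec))

row-≤-firstRow : ∀ t d → Decreasing t → row t d ≤ firstRow t
row-≤-firstRow []      d _   = z≤n
row-≤-firstRow (y ∷ t) d dec = row-≤ (y ∷ t) d (≤-refl ∷ Decreasing-∷⁻ dec)

<colHeight⇔<row : ∀ t → Decreasing t → ∀ d m → d < colHeight t m ⇔ m < row t d
<colHeight⇔<row []      _   d m = mk⇔ (λ ()) (λ ())
<colHeight⇔<row (y ∷ t) dec d m with m <? y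
... | yes m<y rewrite colHeight-∷-< t m<y = inRow d
  where
  inRow : ∀ d → d < suc (colHeight t m) ⇔ m < row (y ∷ t) d
  inRow zero    = mk⇔ (λ _ → m<y) (λ _ → s≤s z≤n)
  inRow (suc d) = mk⇔ (Equivalence.to IH ∘ s≤s⁻¹) (s≤s ∘ Equivalence.from IH)
    where IH = <colHeight⇔<row t (Linked.tail dec) d m
... | no m≮y rewrite colHeight-≥firstRow (y ∷ t) dec (≮⇒≥ m≮y) =
  mk⇔ (λ ()) (λ m<row → ⊥-elim (m≮y (<-≤-trans m<row (row-≤-firstRow (y ∷ t) d dec))))

colHeight-conj : ∀ t → Decreasing t → ∀ d → colHeight (conj t) d ≡ row t d
colHeight-conj t dec d = begin
  length (filter (d <?_) (map (colHeight t) (applyUpTo id (firstRow t))))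
    ≡⟨ cong (length ∘ filter (d <?_)) (map-applyUpTo id (colHeight t) (firstRow t)) ⟩
  length (filter (d <?_) (applyUpTo (colHeight t) (firstRow t)))
    ≡⟨ length-filter-applyUpTo (firstRow t) (d <?_) (colHeight t) ⟩
  Σ< (firstRow t) (λ m → indicator (d <? colHeight t m))
    ≡⟨ Σ<-cong (firstRow t) (λ m _ → indicator-cong (<colHeight⇔<row t dec d m) _ _) ⟩
  Σ< (firstRow t) (λ m → indicator (m <? row t d))
    ≡⟨ Σ<-indicator-< (row t d) (firstRow t) (row-≤-firstRow t d dec) ⟩
  row t d ∎

colHeight-≤-∷ : ∀ {y} t c → colHeight t c ≤ colHeight (y ∷ t) c
colHeight-≤-∷ {y} t c with c <? y
... | yes c<y rewrite colHeight-∷-< t c<y = n≤1+n _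
... | no c≮y  rewrite colHeight-∷-≮ t c≮y = ≤-refl

colHeight-suc-≤ : ∀ t c → colHeight t (suc c) ≤ colHeight t c
colHeight-suc-≤ []      c = z≤n
colHeight-suc-≤ (y ∷ t) c with suc c <? y
... | yes 1+c<y rewrite colHeight-∷-< t 1+c<y | colHeight-∷-< t (<-trans (n<1+n c) 1+c<y) =
  s≤s (colHeight-suc-≤ t c)
... | no 1+c≮y rewrite colHeight-∷-≮ t 1+c≮y =
  ≤-trans (colHeight-suc-≤ t c) (colHeight-≤-∷ {y} t c)

conj-isPartition : ∀ ν → IsPartition (conj ν)
conj-isPartition ν rewrite map-applyUpTo id (colHeight ν) (firstRow ν) =
  All.applyUpTo⁺₁ (colHeight ν) (firstRow ν) (positive ν) ,
  Linked.applyUpTo⁺₂ (colHeight ν) (firstRow ν) (colHeight-suc-≤ ν)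
  where
  positive : ∀ ν {c} → c < firstRow ν → 1 ≤ colHeight ν c
  positive (y ∷ t) c<y rewrite colHeight-∷-< t c<y = s≤s z≤n

-- Induction on the bottom row y: in the columns c < y it raises colHeight by one, and
-- the values y, y + 1, …, B of the remaining columns telescope against the new row.
Σ-colHeight+index≡Σ-row+index : ∀ t B (f : ℕ → ℕ) →
  Decreasing t → All (_≤ B) t → length t ≤ B →
  Σ< B (λ c → f (colHeight t c + c)) ≡ Σ< B (λ r → f (row t r + r))
Σ-colHeight+index≡Σ-row+index []      _       _ _   _               _           = refl
Σ-colHeight+index≡Σ-row+index (y ∷ t) (suc B) f dec (y≤1+B ∷ t≤1+B) (s≤s |t|≤B) =
  +-cancelʳ-≡ (f (suc B)) _ _ (begin
    Σ< (suc B) (λ c → f (colHeight (y ∷ t) c + c)) + f (suc B)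
      ≡⟨ cong (_+ f (suc B)) split-y∷t ⟩
    (Σ< y F + Σ< n (λ i → f (y + i))) + f (suc B)
      ≡⟨ +-assoc (Σ< y F) _ _ ⟩
    Σ< y F + (Σ< n (λ i → f (y + i)) + f (suc B))
      ≡⟨ cong (Σ< y F +_) telescope ⟩
    Σ< y F + (f y + Σ< n (λ i → f (suc (y + i))))
      ≡⟨ x∙yz≈y∙xz (Σ< y F) (f y) _ ⟩
    f y + (Σ< y F + Σ< n (λ i → f (suc (y + i))))
      ≡⟨ cong (f y +_) (trans (sym split-t) IH) ⟩
    f y + Σ< (suc B) (λ r → f (suc (row t r + r)))
      ≡⟨ rows-y∷t ⟩
    Σ< (suc B) (λ r → f (row (y ∷ t) r + r)) + f (suc B) ∎)
  where
  n = suc B ∸ y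
  F : ℕ → ℕ
  F c = f (suc (colHeight t c + c))
  IH : Σ< (suc B) F ≡ Σ< (suc B) (λ r → f (suc (row t r + r)))
  IH = Σ-colHeight+index≡Σ-row+index t (suc B) (f ∘ suc)
         (Linked.tail dec) t≤1+B (m≤n⇒m≤1+n |t|≤B)
  split-y∷t : Σ< (suc B) (λ c → f (colHeight (y ∷ t) c + c)) ≡ Σ< y F + Σ< n (λ i → f (y + i))
  split-y∷t = trans (Σ<-∸ _ y≤1+B) (cong₂ _+_
    (Σ<-cong y (λ c c<y → cong (λ h → f (h + c)) (colHeight-∷-< t c<y)))
    (Σ<-cong n (λ i _ → cong (λ h → f (h + (y + i)))
      (colHeight-≥firstRow (y ∷ t) dec (m≤m+n y i)))))
  split-t : Σ< (suc B) F ≡ Σ< y F + Σ< n (λ i → f (suc (y + i)))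
  split-t = trans (Σ<-∸ F y≤1+B)
    (cong (Σ< y F +_) (Σ<-cong n (λ i _ → cong (λ h → f (suc (h + (y + i))))
      (colHeight-≡0 t (All.map (λ z≤y → ≤-trans z≤y (m≤m+n y i)) (Decreasing-∷⁻ dec))))))
  telescope : Σ< n (λ i → f (y + i)) + f (suc B) ≡ f y + Σ< n (λ i → f (suc (y + i)))
  telescope = begin
    Σ< n (λ i → f (y + i)) + f (suc B)
      ≡⟨ cong (λ x → Σ< n (λ i → f (y + i)) + f x) (m+[n∸m]≡n y≤1+B) ⟨
    Σ< n (λ i → f (y + i)) + f (y + n)
      ≡⟨ Σ<-suc n (λ i → f (y + i)) ⟨
    f (y + 0) + Σ< n (λ i → f (y + suc i))
      ≡⟨ cong₂ (λ x s → f x + s) (+-identityʳ y) (Σ<-cong n (λ i _ → cong f (+-suc y i))) ⟩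
    f y + Σ< n (λ i → f (suc (y + i)))   ∎
  rows-y∷t : f y + Σ< (suc B) (λ r → f (suc (row t r + r)))
           ≡ Σ< (suc B) (λ r → f (row (y ∷ t) r + r)) + f (suc B)
  rows-y∷t = begin
    f y + Σ< (suc B) (λ r → f (suc (row t r + r)))
      ≡⟨ cong (f y +_) (Σ<-suc B _) ⟩
    f y + (Σ< B (λ r → f (suc (row t r + r))) + f (suc (row t B + B)))
      ≡⟨ cong (λ x → f y + (Σ< B (λ r → f (suc (row t r + r))) + f (suc (x + B))))
              (row-≥length t |t|≤B) ⟩
    f y + (Σ< B (λ r → f (suc (row t r + r))) + f (suc B))
      ≡⟨ +-assoc (f y) _ _ ⟨
    (f y + Σ< B (λ r → f (suc (row t r + r)))) + f (suc B)
      ≡⟨ cong₂ (λ x s → (f x + s) + f (suc B)) (+-identityʳ y)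
               (Σ<-cong B (λ r _ → cong f (+-suc (row t r) r))) ⟨
    Σ< (suc B) (λ r → f (row (y ∷ t) r + r)) + f (suc B) ∎

good≡ : ∀ μ r len c → good μ r len c ≡ [ suc (arm μ r c) ≡₃ leg len c ]
good≡ μ r len c with suc (arm μ r c) % 3 ≟ leg len c % 3
... | yes _ = refl
... | no  _ = refl

rowCount≡Σ : ∀ μ r len →
  rowCount μ r len ≡ Σ< len (λ c → [ suc (arm μ r c) ≡₃ leg len c ])
rowCount≡Σ μ r len =
  trans (sum-map-applyUpTo len (good μ r len) id) (Σ<-cong len (λ c _ → good≡ μ r len c))

rowCount-cong : ∀ {μ ν r s} len → (∀ c → c < len → arm μ r c ≡ arm ν s c) →
  rowCount μ r len ≡ rowCount ν s len
rowCount-cong {μ} {ν} {r} {s} len eq = begin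
  rowCount μ r len                                 ≡⟨ rowCount≡Σ μ r len ⟩
  Σ< len (λ c → [ suc (arm μ r c) ≡₃ leg len c ])
    ≡⟨ Σ<-cong len (λ c c<len → cong (λ a → [ suc a ≡₃ leg len c ]) (eq c c<len)) ⟩
  Σ< len (λ c → [ suc (arm ν s c) ≡₃ leg len c ])  ≡⟨ rowCount≡Σ ν s len ⟨
  rowCount ν s len                                 ∎

rowCount-suc : ∀ μ r len →
  rowCount μ r (suc len) ≡ [ suc (arm μ r 0) ≡₃ len ] + rowCount (decAll μ) r len
rowCount-suc μ r len = begin
  rowCount μ r (suc len)
    ≡⟨ rowCount≡Σ μ r (suc len) ⟩
  [ suc (arm μ r 0) ≡₃ len ] + Σ< len (λ c → [ suc (arm μ r (suc c)) ≡₃ leg len c ])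
    ≡⟨ cong ([ suc (arm μ r 0) ≡₃ len ] +_) (Σ<-cong len (λ c _ →
         cong (λ h → [ suc (h ∸ suc r) ≡₃ leg len c ]) (colHeight-decAll μ c))) ⟨
  [ suc (arm μ r 0) ≡₃ len ] + Σ< len (λ c → [ suc (arm (decAll μ) r c) ≡₃ leg len c ])
    ≡⟨ cong ([ suc (arm μ r 0) ≡₃ len ] +_) (rowCount≡Σ (decAll μ) r len) ⟨
  [ suc (arm μ r 0) ≡₃ len ] + rowCount (decAll μ) r len
    ∎

rowsWeight : Partition → ℕ → List ℕ → ℕ
rowsWeight μ r []           = 0
rowsWeight μ r (len ∷ rows) = rowCount μ r len + rowsWeight μ (suc r) rows

-- F abstracts the pattern-matching lambda inside wtZ3, which cannot be written down again.
sum-rowCount-zip : ∀ μ (F : ℕ × ℕ → ℕ) → (∀ r len → F (r , len) ≡ rowCount μ r len) →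
  ∀ (f : ℕ → ℕ) r rows → (∀ i → f i ≡ r + i) →
  sum (map F (zip (applyUpTo f (length rows)) rows)) ≡ rowsWeight μ r rows
sum-rowCount-zip μ F F≡ f r []           f≡ = refl
sum-rowCount-zip μ F F≡ f r (len ∷ rows) f≡ = cong₂ _+_
  (trans (cong (λ i → F (i , len)) (trans (f≡ 0) (+-identityʳ r))) (F≡ r len))
  (sum-rowCount-zip μ F F≡ (λ i → f (suc i)) (suc r) rows
    (λ i → trans (f≡ (suc i)) (+-suc r i)))

wtZ3≡rowsWeight : ∀ μ → wtZ3 μ ≡ rowsWeight μ 0 μ
wtZ3≡rowsWeight μ = sum-rowCount-zip μ _ (λ _ _ → refl) id 0 μ (λ _ → refl)

rowsWeight-∷ : ∀ {x} t r rows → All (_≤ x) rows →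
  rowsWeight (x ∷ t) (suc r) rows ≡ rowsWeight t r rows
rowsWeight-∷ t r []           []                = refl
rowsWeight-∷ t r (len ∷ rows) (len≤x ∷ rows≤x) = cong₂ _+_
  (rowCount-cong len (λ c c<len →
    cong (_∸ suc (suc r)) (colHeight-∷-< t (<-≤-trans c<len len≤x))))
  (rowsWeight-∷ t (suc r) rows rows≤x)

rowsWeight-peelColumn : ∀ μ r rows → All (1 ≤_) rows →
  rowsWeight μ r rows ≡
  Σ< (length rows) (λ i → [ suc (arm μ (r + i) 0) ≡₃ pred (row rows i) ])
    + rowsWeight (decAll μ) r (map pred rows)
rowsWeight-peelColumn μ r []               []            = refl
rowsWeight-peelColumn μ r (suc len ∷ rows) (_ ∷ rows>0) = begin
  rowCount μ r (suc len) + rowsWeight μ (suc r) rows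
    ≡⟨ cong₂ _+_ (rowCount-suc μ r len) (rowsWeight-peelColumn μ (suc r) rows rows>0) ⟩
  (corner r + rowCount (decAll μ) r len)
    + (column (suc r) + rowsWeight (decAll μ) (suc r) (map pred rows))
    ≡⟨ interchange (corner r) _ _ _ ⟩
  (corner r + column (suc r)) + rest
    ≡⟨ cong₂ (λ s c → (corner s + c) + rest) (+-identityʳ r)
         (Σ<-cong (length rows) (λ i _ →
           cong (λ s → [ suc (arm μ s 0) ≡₃ pred (row rows i) ]) (+-suc r i))) ⟨
  Σ< (length (suc len ∷ rows)) (λ i → [ suc (arm μ (r + i) 0) ≡₃ pred (row (suc len ∷ rows) i) ])
    + rowsWeight (decAll μ) r (map pred (suc len ∷ rows))
    ∎
  where
  corner : ℕ → ℕ
  corner s = [ suc (arm μ s 0) ≡₃ len ]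
  column : ℕ → ℕ
  column s = Σ< (length rows) (λ i → [ suc (arm μ (s + i) 0) ≡₃ pred (row rows i) ])
  rest = rowCount (decAll μ) r len + rowsWeight (decAll μ) (suc r) (map pred rows)

rowsWeight-zeros : ∀ μ r rows → All (_≤ 0) rows → rowsWeight μ r rows ≡ 0
rowsWeight-zeros μ r []         []             = refl
rowsWeight-zeros μ r (0 ∷ rows) (z≤n ∷ rows≤0) = rowsWeight-zeros μ (suc r) rows rows≤0

rowsWeight-filter-positive : ∀ μ r rows → Decreasing rows →
  rowsWeight μ r (filter (0 <?_) rows) ≡ rowsWeight μ r rows
rowsWeight-filter-positive μ r []            _   = refl
rowsWeight-filter-positive μ r (zero ∷ rows) dec = begin
  rowsWeight μ r (filter (0 <?_) rows)
    ≡⟨ cong (rowsWeight μ r) (filter-none (0 <?_) (All.map (λ { z≤n () }) rows≤0)) ⟩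
  0 ≡⟨ rowsWeight-zeros μ (suc r) rows rows≤0 ⟨
  rowsWeight μ (suc r) rows ∎
  where rows≤0 = Decreasing-∷⁻ dec
rowsWeight-filter-positive μ r (suc y ∷ rows) dec =
  cong (rowCount μ r (suc y) +_) (rowsWeight-filter-positive μ (suc r) rows (Linked.tail dec))

bottomRowWeight : ℕ → Partition → ℕ
bottomRowWeight x t = Σ< x (λ c → [ suc (colHeight t c) ≡₃ x ∸ suc c ])

firstColumnWeight : Partition → ℕ
firstColumnWeight l = Σ< (length l) (λ r → [ suc (length l ∸ suc r) ≡₃ pred (row l r) ])

wtZ3-∷ : ∀ x t → Decreasing (x ∷ t) → wtZ3 (x ∷ t) ≡ bottomRowWeight x t + wtZ3 t
wtZ3-∷ x t dec = begin
  wtZ3 (x ∷ t)                                   ≡⟨ wtZ3≡rowsWeight (x ∷ t) ⟩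
  rowCount (x ∷ t) 0 x + rowsWeight (x ∷ t) 1 t
    ≡⟨ cong₂ _+_ (rowCount≡Σ (x ∷ t) 0 x) (rowsWeight-∷ t 0 t (Decreasing-∷⁻ dec)) ⟩
  Σ< x (λ c → [ suc (arm (x ∷ t) 0 c) ≡₃ leg x c ]) + rowsWeight t 0 t
    ≡⟨ cong₂ _+_
         (Σ<-cong x (λ c c<x → cong (λ h → [ suc (h ∸ 1) ≡₃ leg x c ]) (colHeight-∷-< t c<x)))
         (sym (wtZ3≡rowsWeight t)) ⟩
  bottomRowWeight x t + wtZ3 t                   ∎

wtZ3-decAll : ∀ l → IsPartition l → wtZ3 l ≡ firstColumnWeight l + wtZ3 (decAll l)
wtZ3-decAll l (l>0 , dec) = begin
  wtZ3 l                                                    ≡⟨ wtZ3≡rowsWeight l ⟩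
  rowsWeight l 0 l                                          ≡⟨ rowsWeight-peelColumn l 0 l l>0 ⟩
  Σ< (length l) (λ r → [ suc (colHeight l 0 ∸ suc r) ≡₃ pred (row l r) ])
    + rowsWeight (decAll l) 0 (map pred l)
    ≡⟨ cong₂ _+_
         (cong (λ h → Σ< (length l) (λ r → [ suc (h ∸ suc r) ≡₃ pred (row l r) ]))
               (colHeight-0 l l>0))
         (sym (rowsWeight-filter-positive (decAll l) 0 (map pred l)
                 (Linked.map⁺ (Linked.map pred-mono-≤ dec)))) ⟩
  firstColumnWeight l + rowsWeight (decAll l) 0 (decAll l)  ≡⟨ cong (firstColumnWeight l +_)
                                                                    (wtZ3≡rowsWeight (decAll l)) ⟨
  firstColumnWeight l + wtZ3 (decAll l)                     ∎

All-row : ∀ {P : ℕ → Set} {xs r} → All P xs → r < length xs → P (row xs r)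
All-row {r = zero}  (px ∷ _)  _         = px
All-row {r = suc r} (_ ∷ pxs) (s≤s r<n) = All-row pxs r<n

bottomRowWeight≡Σ : ∀ N t → bottomRowWeight N t ≡ Σ< N (λ c → [ colHeight t c + c ≡₃ suc N ])
bottomRowWeight≡Σ N t = Σ<-cong N (λ c c<N →
  trans ([1+h≡₃d]≡[h+c≡₃2+c+d] (colHeight t c) c (N ∸ suc c))
        (cong (λ n → [ colHeight t c + c ≡₃ suc n ]) (m+[n∸m]≡n c<N)))

firstColumnWeight≡Σ : ∀ l → All (1 ≤_) l →
  firstColumnWeight l ≡ Σ< (length l) (λ r → [ row l r + r ≡₃ suc (length l) ])
firstColumnWeight≡Σ l l>0 = Σ<-cong (length l) (λ r r<k → begin
  [ suc (length l ∸ suc r) ≡₃ pred (row l r) ]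
    ≡⟨ [1+d≡₃t]≡[t+r≡₃1+r+d] (pred (row l r)) r (length l ∸ suc r) ⟩
  [ pred (row l r) + r ≡₃ suc r + (length l ∸ suc r) ]
    ≡⟨ cong [ pred (row l r) + r ≡₃_] (m+[n∸m]≡n r<k) ⟩
  [ pred (row l r) + r ≡₃ length l ]
    ≡⟨ [≡₃]-+ˡ 1 (pred (row l r) + r) (length l) ⟨
  [ suc (pred (row l r)) + r ≡₃ suc (length l) ]
    ≡⟨ cong (λ x → [ x + r ≡₃ suc (length l) ])
            (suc-pred (row l r) {{>-nonZero (All-row l>0 r<k)}}) ⟩
  [ row l r + r ≡₃ suc (length l) ]
    ∎)

firstColumnWeight-applyUpTo : ∀ (f : ℕ → ℕ) n →
  firstColumnWeight (applyUpTo (λ r → suc (f r)) n) ≡ Σ< n (λ r → [ f r + r ≡₃ n ])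
firstColumnWeight-applyUpTo f n = begin
  firstColumnWeight μ
    ≡⟨ firstColumnWeight≡Σ μ (All.applyUpTo⁺₂ (λ r → suc (f r)) n (λ _ → s≤s z≤n)) ⟩
  Σ< (length μ) (λ r → [ row μ r + r ≡₃ suc (length μ) ])
    ≡⟨ cong (λ m → Σ< m (λ r → [ row μ r + r ≡₃ suc m ]))
            (length-applyUpTo (λ r → suc (f r)) n) ⟩
  Σ< n (λ r → [ row μ r + r ≡₃ suc n ])
    ≡⟨ Σ<-cong n (λ r r<n →
         trans (cong (λ y → [ y + r ≡₃ suc n ]) (row-applyUpTo (λ r → suc (f r)) n r<n))
               ([≡₃]-+ˡ 1 (f r + r) n)) ⟩
  Σ< n (λ r → [ f r + r ≡₃ n ])
    ∎
  where μ = applyUpTo (λ r → suc (f r)) n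

applyUpTo-cong : ∀ n {f g : ℕ → ℕ} → (∀ i → i < n → f i ≡ g i) →
  applyUpTo f n ≡ applyUpTo g n
applyUpTo-cong zero    eq = refl
applyUpTo-cong (suc n) eq =
  cong₂ _∷_ (eq 0 (s≤s z≤n)) (applyUpTo-cong n (λ i i<n → eq (suc i) (s≤s i<n)))

rho1-∷ : ∀ x t → Decreasing (x ∷ t) → rho1 (x ∷ t) ≡ applyUpTo (λ r → suc (row t r)) (suc x)
rho1-∷ x t dec =
  trans (map-applyUpTo id (colHeight ν) (suc x)) (applyUpTo-cong (suc x) (λ c c<1+x →
    trans (colHeight-∷-< (decAll (conj (x ∷ t))) c<1+x)
          (cong suc (trans (colHeight-decAll (conj (x ∷ t)) c) (colHeight-conj (x ∷ t) dec (suc c))))))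
  where ν = suc x ∷ decAll (conj (x ∷ t))

decAll-applyUpTo-row : ∀ t n → All (1 ≤_) t → length t ≤ n →
  decAll (applyUpTo (λ r → suc (row t r)) n) ≡ t
decAll-applyUpTo-row t n t>0 |t|≤n = begin
  filter (0 <?_) (map pred (applyUpTo (λ r → suc (row t r)) n))
    ≡⟨ cong (filter (0 <?_)) (trans (map-applyUpTo _ pred n) (applyUpTo-row t n |t|≤n)) ⟩
  filter (0 <?_) (t ++ replicate (n ∸ length t) 0)
    ≡⟨ filter-++ (0 <?_) t _ ⟩
  filter (0 <?_) t ++ filter (0 <?_) (replicate (n ∸ length t) 0)
    ≡⟨ cong₂ _++_ (filter-all (0 <?_) t>0)
                  (filter-none (0 <?_) (All.replicate⁺ (n ∸ length t) (λ ()))) ⟩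
  t ++ []
    ≡⟨ ++-identityʳ t ⟩
  t ∎

wtZ3-rho1 : ∀ x t → IsPartition (x ∷ t) → length t ≤ suc x →
  wtZ3 (rho1 (x ∷ t)) ≡ wtZ3 (x ∷ t)
wtZ3-rho1 x t (_ ∷ t>0 , dec) |t|≤1+x = begin
  wtZ3 (rho1 (x ∷ t))
    ≡⟨ wtZ3-decAll (rho1 (x ∷ t)) (conj-isPartition _) ⟩
  firstColumnWeight (rho1 (x ∷ t)) + wtZ3 (decAll (rho1 (x ∷ t)))
    ≡⟨ cong (λ μ → firstColumnWeight μ + wtZ3 (decAll μ)) (rho1-∷ x t dec) ⟩
  firstColumnWeight μ + wtZ3 (decAll μ)
    ≡⟨ cong₂ _+_ (firstColumnWeight-applyUpTo (row t) (suc x))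
                 (cong wtZ3 (decAll-applyUpTo-row t (suc x) t>0 |t|≤1+x)) ⟩
  Σ< (suc x) (λ r → [ row t r + r ≡₃ suc x ]) + wtZ3 t
    ≡⟨ cong (_+ wtZ3 t) (Σ-colHeight+index≡Σ-row+index t (suc x) [_≡₃ suc x ]
                           (Linked.tail dec) (All.map m≤n⇒m≤1+n t≤x) |t|≤1+x) ⟨
  Σ< (suc x) (λ c → [ colHeight t c + c ≡₃ suc x ]) + wtZ3 t
    ≡⟨ cong (_+ wtZ3 t) bottomRow ⟨
  bottomRowWeight x t + wtZ3 t
    ≡⟨ wtZ3-∷ x t dec ⟨
  wtZ3 (x ∷ t)
    ∎
  where
  t≤x = Decreasing-∷⁻ dec
  μ = applyUpTo (λ r → suc (row t r)) (suc x)
  g : ℕ → ℕ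
  g c = [ colHeight t c + c ≡₃ suc x ]
  lastColumn : g x ≡ [ 0 ≡₃ 1 ]
  lastColumn = trans (cong (λ h → [ h + x ≡₃ suc x ]) (colHeight-≡0 t t≤x)) ([≡₃]-+ʳ x 0 1)
  bottomRow : bottomRowWeight x t ≡ Σ< (suc x) g
  bottomRow = begin
    bottomRowWeight x t    ≡⟨ bottomRowWeight≡Σ x t ⟩
    Σ< x g                 ≡⟨ +-identityʳ _ ⟨
    Σ< x g + [ 0 ≡₃ 1 ]    ≡⟨ cong (Σ< x g +_) lastColumn ⟨
    Σ< x g + g x           ≡⟨ Σ<-suc x g ⟨
    Σ< (suc x) g           ∎

wtZ3-psi2 : ∀ l → IsPartition l → firstRow l ≤ 3 + length l → wtZ3 (psi2 l) ≡ wtZ3 l + 1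
wtZ3-psi2 l (l>0 , dec) l₁≤3+k = begin
  wtZ3 (2 + k ∷ decAll l)                               ≡⟨ wtZ3-∷ (2 + k) (decAll l) dec′ ⟩
  bottomRowWeight (2 + k) (decAll l) + wtZ3 (decAll l)  ≡⟨ cong (_+ wtZ3 (decAll l)) bottomRow ⟩
  (firstColumnWeight l + 1) + wtZ3 (decAll l)           ≡⟨ xy∙z≈xz∙y (firstColumnWeight l) 1 _ ⟩
  (firstColumnWeight l + wtZ3 (decAll l)) + 1           ≡⟨ cong (_+ 1) (wtZ3-decAll l (l>0 , dec)) ⟨
  wtZ3 l + 1                                            ∎
  where
  k = length l
  dec₃ : Decreasing (3 + k ∷ l)
  dec₃ = Decreasing-∷⁺ l l₁≤3+k dec
  dec′ : Decreasing (2 + k ∷ decAll l)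
  dec′ = Linked.∷-filter⁺ (0 <?_) (λ p q → ≤-trans q p)
           (Linked.map⁺ (Linked.map pred-mono-≤ dec₃))
  f : ℕ → ℕ
  f = [_≡₃ 4 + k ]
  corner : f (colHeight l 0 + 0) ≡ 0
  corner = trans (cong (λ h → f (h + 0)) (colHeight-0 l l>0))
                 (trans (cong f (+-identityʳ k)) ([≡₃]-+ʳ k 0 4))
  emptyRows : Σ< 3 (λ i → f (row l (k + i) + (k + i))) ≡ 1
  emptyRows = Σ<-cong 3 {g = λ i → [ i ≡₃ 4 ]} (λ i _ →
    trans (cong (λ y → f (y + (k + i))) (row-≥length l (m≤m+n k i)))
          (trans (cong f (+-comm k i)) ([≡₃]-+ʳ k i 4)))
  shifted : ∀ c → [ colHeight (decAll l) c + c ≡₃ 3 + k ] ≡ f (colHeight l (suc c) + suc c)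
  shifted c = begin
    [ colHeight (decAll l) c + c ≡₃ 3 + k ]
      ≡⟨ cong (λ h → [ h + c ≡₃ 3 + k ]) (colHeight-decAll l c) ⟩
    [ colHeight l (suc c) + c ≡₃ 3 + k ]
      ≡⟨ [≡₃]-+ˡ 1 (colHeight l (suc c) + c) (3 + k) ⟨
    f (suc (colHeight l (suc c) + c))
      ≡⟨ cong f (+-suc (colHeight l (suc c)) c) ⟨
    f (colHeight l (suc c) + suc c)
      ∎
  bottomRow : bottomRowWeight (2 + k) (decAll l) ≡ firstColumnWeight l + 1
  bottomRow = begin
    bottomRowWeight (2 + k) (decAll l)
      ≡⟨ bottomRowWeight≡Σ (2 + k) (decAll l) ⟩
    Σ< (2 + k) (λ c → [ colHeight (decAll l) c + c ≡₃ 3 + k ])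
      ≡⟨ Σ<-cong (2 + k) (λ c _ → shifted c) ⟩
    Σ< (2 + k) (λ c → f (colHeight l (suc c) + suc c))
      ≡⟨ cong (_+ Σ< (2 + k) (λ c → f (colHeight l (suc c) + suc c))) corner ⟨
    Σ< (3 + k) (λ c → f (colHeight l c + c))
      ≡⟨ Σ-colHeight+index≡Σ-row+index l (3 + k) f dec (Decreasing-∷⁻ dec₃) (m≤n+m k 3) ⟩
    Σ< (3 + k) (λ r → f (row l r + r))
      ≡⟨ cong (λ m → Σ< m (λ r → f (row l r + r))) (+-comm 3 k) ⟩
    Σ< (k + 3) (λ r → f (row l r + r))
      ≡⟨ Σ<-+ k 3 (λ r → f (row l r + r)) ⟩
    Σ< k (λ r → f (row l r + r)) + Σ< 3 (λ i → f (row l (k + i) + (k + i)))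
      ≡⟨ cong₂ _+_ (Σ<-cong k (λ r _ → [≡₃]-3+ʳ (row l r + r) (suc k))) emptyRows ⟩
    Σ< k (λ r → [ row l r + r ≡₃ suc k ]) + 1
      ≡⟨ cong (_+ 1) (firstColumnWeight≡Σ l l>0) ⟨
    firstColumnWeight l + 1
      ∎

theorem3p7 : (λ′ : Partition) → IsPartition λ′ →
    ((length λ′ ≤ firstRow λ′ + 2) → wtZ3 (rho1 λ′) ≡ wtZ3 λ′)
    × ((firstRow λ′ ≤ length λ′ + 3) → wtZ3 (psi2 λ′) ≡ wtZ3 λ′ + 1)
theorem3p7 λ′ isPartition = rho1-case λ′ isPartition , psi2-case
  where
  rho1-case : ∀ l → IsPartition l → length l ≤ firstRow l + 2 → wtZ3 (rho1 l) ≡ wtZ3 l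
  rho1-case []      _ _         = refl
  rho1-case (x ∷ t) p |l|≤x+2 =
    wtZ3-rho1 x t p (s≤s⁻¹ (subst (suc (length t) ≤_) (+-comm x 2) |l|≤x+2))
  psi2-case : firstRow λ′ ≤ length λ′ + 3 → wtZ3 (psi2 λ′) ≡ wtZ3 λ′ + 1
  psi2-case l₁≤k+3 =
    wtZ3-psi2 λ′ isPartition (subst (firstRow λ′ ≤_) (+-comm (length λ′) 3) l₁≤k+3)
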